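{- Let $S$ be a finite alphabet and $F_S$ the sequential cellular automaton of radius $\frac12$ over $\Sigma_S$ described in the context. For every $n\ge1$ and every $x\in S^n$ having a symbol $s\in S$ in strict majority (i.e. $|x|_s>|x|_t$ for every $t\in S\setminus\{s\}$), there exists $K$ such that $F_S^k(x)=s^n$ for all $k\ge K$, and $s^n$ is a fixed point of $F_S$. (That is, $F_S$ solves the density classification task over $S$ using an intermediate alphabet.) This holds for any choice of the unspecified values in rule (R5).
   Context: $S$ is a finite set, $X\notin S$ a new symbol, and $|x|_t$ the number of positions of $x\in S^n$ equal to $t$. The alphabet is $\Sigma_S=S\cup(\{\circ,\bullet\}\times(S\cup\{X\})\times 2^S)$, where $2^S$ is the power set of $S$; a triple $(c,v,M)$ is an intermediate symbol with counter $c$, value $v$ and memory $M$; $\bar c$ is the other counter symbol. Local rule $f_S:\Sigma_S\times\Sigma_S\to\Sigma_S$, $f_S(a,y)$ with $a$ the left neighbour and $y$ the updated cell: (R1) $f_S(s,s)=s$ for $s\in S$; (R2) $f_S(s,s')=(\circ,X,\{s'\})$ for $s\neq s'$ in $S$; (R3) for $t\in S$: $f_S((c,v,M),t)=(c,X,M\cup\{t\})$ if $t\notin M$, $=(c,t,M)$ if $t\in M$; (R4) for $c'\neq c$: $f_S((c,v,M),(c',w,M'))=(c,X,M\cup\{w\})$ if $w\in S\setminus M$, $=(c,w,M)$ if $w\in M\cup\{X\}$; (R5) $f_S((c,v,M),(c,w,M'))=(\bar c,X,\emptyset)$ if $|M|\ge2$; $=t$ if $M=\{t\}$; an arbitrary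 fixed element of $\Sigma_S$ if $M=\emptyset$; (R6) $f_S(t,(c,v,M))=t$ for $t\in S$. Configurations $z\in\Sigma_S^n$ are cyclic with cells $1,\dots,n$, the left neighbour of cell $1$ being cell $n$. One application of $F_S$ performs, for $i=1,\dots,n$ in this order, $z_i:=f_S(z_{i-1},z_i)$ (with $z_0:=z_n$), using current values. $F_S^k$ is $k$ applications of $F_S$. -}

module Defs where

open import Data.Nat using (ℕ; zero; suc)
open import Data.Bool using (Bool; true; false) renaming (_≟_ to _≟ᵇ_)
open import Data.Maybe using (Maybe; just; nothing)
open import Data.Fin using (Fin) renaming (_≟_ to _≟ᶠ_)
open import Data.Fin.Properties using (any?)
open import Data.Fin.Subset using (Subset; ⁅_⁆; _∪_) renaming (⊥ to ∅)
open import Data.Fin.Subset.Properties using (_∈?_)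
open import Data.Vec using (Vec; []; _∷_; last; count)
open import Data.Vec.Properties using (≡-dec)
open import Data.Product using (_,_)
open import Relation.Nullary using (Dec; yes; no)
open import Relation.Binary.PropositionalEquality using (_≡_; refl)

-- The finite alphabet S is Fin m.
-- Counters ∘ / • :
data Cnt : Set where
  white black : Cnt

flipC : Cnt → Cnt
flipC white = black
flipC black = white

_≟ᶜ_ : (c d : Cnt) → Dec (c ≡ d)
white ≟ᶜ white = yes refl
white ≟ᶜ black = no (λ ())
black ≟ᶜ white = no (λ ())
black ≟ᶜ black = yes refl

-- Σ_S = S ∪ ({∘,•} × (S ∪ {X}) × 2^S).  Value X is `nothing`.
data Sym (m : ℕ) : Set where
  base : Fin m → Sym m
  mid  : Cnt → Maybe (Fin m) → Subset m → Sym m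

-- The unspecified value of rule (R5) when M = ∅; allowed to depend on
-- all remaining data of the two arguments (c,v,∅) and (c,w,M') (most general choice).
Default : ℕ → Set
Default m = Cnt → Maybe (Fin m) → Maybe (Fin m) → Subset m → Sym m

-- the local rule f_S(a , y), a = left neighbour
f : {m : ℕ} → Default m → Sym m → Sym m → Sym m
f g (base s) (base s') with s ≟ᶠ s'
... | yes _ = base s
... | no  _ = mid white nothing ⁅ s' ⁆
f g (mid c v M) (base t) with t ∈? M
... | yes _ = mid c (just t) M
... | no  _ = mid c nothing (M ∪ ⁅ t ⁆)
f g (mid c v M) (mid c' w M') with c ≟ᶜ c'
f g (mid c v M) (mid c' nothing M') | no _ = mid c nothing M
f g (mid c v M) (mid c' (just u) M') | no _ with u ∈? M
... | yes _ = mid c (just u) M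
... | no  _ = mid c nothing (M ∪ ⁅ u ⁆)
f g (mid c v M) (mid c' w M') | yes _ with ≡-dec _≟ᵇ_ M ∅
... | yes _ = g c v w M'
... | no  _ with any? (λ t → ≡-dec _≟ᵇ_ M ⁅ t ⁆)
...   | yes (t , _) = base t
...   | no  _ = mid (flipC c) nothing ∅
f g (base t) (mid c v M) = base t

sweep : {m n : ℕ} → Default m → Sym m → Vec (Sym m) n → Vec (Sym m) n
sweep g prev [] = []
sweep g prev (y ∷ ys) = let y' = f g prev y in y' ∷ sweep g y' ys

F : {m n : ℕ} → Default m → Vec (Sym m) n → Vec (Sym m) n
F g [] = []
F g (x ∷ xs) = sweep g (last (x ∷ xs)) (x ∷ xs)

iter : {A : Set} → ℕ → (A → A) → A → A
iter zero    h a = a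
iter (suc k) h a = h (iter k h a)

occ : {m n : ℕ} → Fin m → Vec (Fin m) n → ℕ
occ t x = count (λ u → u ≟ᶠ t) x

module Submission where

-- From the first cell that differs from its left neighbour, a wave with counter ∘ runs around
-- the ring: every cell it passes hands its value to the wave's memory M if that colour is not
-- there yet and keeps it otherwise (R3, R4), so when the wave is back at its head, each colour
-- of M has lost exactly one token and s ∈ M.  If M = {s}, the head becomes s, which then
-- spreads over the ring by (R6).  Otherwise (R5) the head restarts a wave with the other
-- counter on the remaining tokens, among which s is still a strict majority, with one token
-- fewer; so there are at most |x|_s rounds.

open import Defs
open import Data.Nat using (ℕ; zero; suc; pred; _+_; _*_; _∸_; _<_; _≤_; _≥_; z≤n; s≤s; >-nonZero)
open import Data.Nat.Properties using (≤-trans; ≤-pred; +-assoc; +-identityʳ; m<n⇒0<n; m≤m*n; m∸n+n≡m; suc-pred; suc-injective)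
open import Data.Nat.Tactic.RingSolver using (solve-∀)
open import Data.Bool using (true; false; if_then_else_) renaming (_≟_ to _≟ᵇ_)
open import Data.Maybe using (Maybe; just; nothing)
open import Data.Fin using (Fin) renaming (_≟_ to _≟ᶠ_)
open import Data.Fin.Properties using (any?)
open import Data.Fin.Subset using (Subset; ⁅_⁆; _∪_; _∈_; _∉_; _⊆_) renaming (⊥ to ∅)
open import Data.Fin.Subset.Properties using (_∈?_; ∉⊥; x∈⁅x⁆; x∈⁅y⁆⇒x≡y; ⊆-antisym; p⊆p∪q; q⊆p∪q; x∈p∪q⁻)
open import Data.Vec using (Vec; []; _∷_; last; map; replicate; toList)
open import Data.Vec.Properties using (≡-dec; toList-map; toList-replicate; length-toList)
open import Data.List as L using (List; []; _∷_; _++_; length)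
open import Data.List.Properties using (++-assoc; ++-identityʳ; map-++)
open import Data.List.Relation.Unary.All as All using (All; []; _∷_)
open import Data.List.Relation.Unary.All.Properties using (++⁺; map⁺; replicate⁺)
import Data.List.Relation.Unary.First as First
open import Data.List.Relation.Unary.First.Properties using (toView)
open import Data.Product using (∃; _×_; _,_; proj₁; proj₂)
open import Data.Sum using (_⊎_; inj₁; inj₂; [_,_]′)
open import Function using (id; _∘_)
open import Relation.Nullary using (yes; no; does; contradiction)
open import Relation.Nullary.Decidable using (_×-dec_; ¬?; toSum; decidable-stable)
open import Relation.Binary.PropositionalEquality

private
  variable
    A : Set
    m n : ℕ

lastOr : A → List A → A
lastOr d []       = d
lastOr d (x ∷ xs) = lastOr x xs

lastOr-++-∷ : (d : A) (xs : List A) (y : A) (ys : List A) → lastOr d (xs ++ y ∷ ys) ≡ lastOr y ys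
lastOr-++-∷ d []       y ys = refl
lastOr-++-∷ d (x ∷ xs) y ys = lastOr-++-∷ x xs y ys

lastOr-∷ʳ : (d : A) (xs : List A) (y : A) → lastOr d (xs ++ y ∷ []) ≡ y
lastOr-∷ʳ d xs y = lastOr-++-∷ d xs y []

lastOr-map : {B : Set} (h : A → B) (d : A) (xs : List A) → lastOr (h d) (L.map h xs) ≡ h (lastOr d xs)
lastOr-map h d []       = refl
lastOr-map h d (x ∷ xs) = lastOr-map h x xs

lastOr-All : {P : A → Set} {d : A} {xs : List A} → P d → All P xs → P (lastOr d xs)
lastOr-All pd []         = pd
lastOr-All pd (px ∷ pxs) = lastOr-All px pxs

last≡lastOr : (x : A) (xs : Vec A n) → last (x ∷ xs) ≡ lastOr x (toList xs)
last≡lastOr x []       = refl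
last≡lastOr x (y ∷ xs) = last≡lastOr y xs

All≡⇒replicate : {a : A} (v : Vec A n) → All (_≡ a) (toList v) → v ≡ replicate n a
All≡⇒replicate []      []         = refl
All≡⇒replicate (x ∷ v) (refl ∷ p) = cong (x ∷_) (All≡⇒replicate v p)

iter-+ : ∀ j k (h : A → A) a → iter (j + k) h a ≡ iter j h (iter k h a)
iter-+ zero    k h a = refl
iter-+ (suc j) k h a = cong h (iter-+ j k h a)

iter-suc : ∀ k (h : A → A) a → iter (suc k) h a ≡ iter k h (h a)
iter-suc zero    h a = refl
iter-suc (suc k) h a = cong h (iter-suc k h a)

-- A sequential sweep is a sequence of rotations of the cyclic word: the first cell is
-- updated from the last one and moved to the end.
module Rotation {A : Set} (h : A → A → A) where

  rotate : List A → List A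
  rotate []       = []
  rotate (a ∷ as) = as ++ h (lastOr a as) a ∷ []

  sweepList : A → List A → List A
  sweepList d []       = []
  sweepList d (y ∷ ys) = h d y ∷ sweepList (h d y) ys

  iter-rotate : ∀ d ys zs → lastOr d (ys ++ zs) ≡ d →
                iter (length ys) rotate (ys ++ zs) ≡ zs ++ sweepList d ys
  iter-rotate d []       zs _      = sym (++-identityʳ zs)
  iter-rotate d (y ∷ ys) zs last≡d = begin
    iter (suc (length ys)) rotate (y ∷ ys ++ zs)     ≡⟨ iter-suc (length ys) rotate _ ⟩
    iter (length ys) rotate (rotate (y ∷ ys ++ zs))  ≡⟨ cong (λ e → iter (length ys) rotate ((ys ++ zs) ++ h e y ∷ [])) last≡d ⟩
    iter (length ys) rotate ((ys ++ zs) ++ y′ ∷ [])  ≡⟨ cong (iter (length ys) rotate) (++-assoc ys zs (y′ ∷ [])) ⟩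
    iter (length ys) rotate (ys ++ zs ++ y′ ∷ [])    ≡⟨ iter-rotate y′ ys (zs ++ y′ ∷ []) last≡y′ ⟩
    (zs ++ y′ ∷ []) ++ sweepList y′ ys               ≡⟨ ++-assoc zs (y′ ∷ []) (sweepList y′ ys) ⟩
    zs ++ sweepList d (y ∷ ys)                       ∎
    where
    open ≡-Reasoning
    y′ = h d y
    last≡y′ : lastOr y′ (ys ++ zs ++ y′ ∷ []) ≡ y′
    last≡y′ = trans (cong (lastOr y′) (sym (++-assoc ys zs (y′ ∷ [])))) (lastOr-∷ʳ y′ (ys ++ zs) y′)

  iter-rotate-cycle : ∀ y ys → iter (suc (length ys)) rotate (y ∷ ys) ≡ sweepList (lastOr y ys) (y ∷ ys)
  iter-rotate-cycle y ys =
    trans (cong (λ zs → iter (suc (length ys)) rotate (y ∷ zs)) (sym (++-identityʳ ys)))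
          (iter-rotate (lastOr y ys) (y ∷ ys) [] (cong (lastOr y) (++-identityʳ ys)))

  module _ {P : A → Set} (close : ∀ {a b} → P a → P b → P (h a b)) where

    rotate-All : ∀ {zs} → All P zs → All P (rotate zs)
    rotate-All []         = []
    rotate-All (pa ∷ pas) = ++⁺ pas (close (lastOr-All pa pas) pa ∷ [])

    iter-rotate-All : ∀ {zs} → All P zs → ∀ k → All P (iter k rotate zs)
    iter-rotate-All pzs zero    = pzs
    iter-rotate-All pzs (suc k) = rotate-All (iter-rotate-All pzs k)

value : Sym m → Maybe (Fin m)
value (base t)    = just t
value (mid _ v _) = v

occurrences : Fin m → Maybe (Fin m) → ℕ
occurrences t nothing  = 0
occurrences t (just u) = if does (u ≟ᶠ t) then 1 else 0

valueCount : Fin m → List (Sym m) → ℕ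
valueCount t []       = 0
valueCount t (z ∷ zs) = occurrences t (value z) + valueCount t zs

valueCount-++ : (t : Fin m) (xs ys : List (Sym m)) → valueCount t (xs ++ ys) ≡ valueCount t xs + valueCount t ys
valueCount-++ t []       ys = refl
valueCount-++ t (x ∷ xs) ys =
  trans (cong (occurrences t (value x) +_) (valueCount-++ t xs ys))
        (sym (+-assoc (occurrences t (value x)) (valueCount t xs) (valueCount t ys)))

occ≡valueCount : (t : Fin m) (x : Vec (Fin m) n) → occ t x ≡ valueCount t (L.map base (toList x))
occ≡valueCount t []      = refl
occ≡valueCount t (u ∷ x) with does (u ≟ᶠ t)
... | true  = cong suc (occ≡valueCount t x)
... | false = occ≡valueCount t x

valueCount-absent : ∀ {b t : Fin m} xs → All (_≡ b) xs → b ≢ t → valueCount t (L.map base xs) ≡ 0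
valueCount-absent []       []         _   = refl
valueCount-absent {b = b} {t} (x ∷ xs) (refl ∷ p) b≢t with b ≟ᶠ t
... | yes b≡t = contradiction b≡t b≢t
... | no  _   = valueCount-absent xs p b≢t

Majority : (Fin m → ℕ) → Fin m → Set
Majority N s = ∀ t → t ≢ s → N t < N s

majority-occurs : ∀ {s : Fin m} x xs → Majority (λ t → valueCount t (L.map base (x ∷ xs))) s →
                  0 < valueCount s (L.map base (x ∷ xs))
majority-occurs {s = s} x xs maj with x ≟ᶠ s
... | yes _   = s≤s z≤n
... | no  x≢s = m<n⇒0<n (maj x x≢s)

indicator : Subset m → Fin m → ℕ
indicator M t = if does (t ∈? M) then 1 else 0

indicator-∈ : {t : Fin m} {M : Subset m} → t ∈ M → indicator M t ≡ 1
indicator-∈ {t = t} {M} t∈M with t ∈? M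
... | yes _   = refl
... | no  t∉M = contradiction t∈M t∉M

indicator-∉ : {t : Fin m} {M : Subset m} → t ∉ M → indicator M t ≡ 0
indicator-∉ {t = t} {M} t∉M with t ∈? M
... | yes t∈M = contradiction t∈M t∉M
... | no  _   = refl

indicator-∪⁅⁆ : {t a : Fin m} {M : Subset m} → t ≢ a → indicator (M ∪ ⁅ a ⁆) t ≡ indicator M t
indicator-∪⁅⁆ {t = t} {a} {M} t≢a with t ∈? M
... | yes t∈M = indicator-∈ (p⊆p∪q ⁅ a ⁆ t∈M)
... | no  t∉M = indicator-∉ λ t∈ → [ t∉M , t≢a ∘ x∈⁅y⁆⇒x≡y a ]′ (x∈p∪q⁻ M ⁅ a ⁆ t∈)

indicator-⁅⁆ : (a t : Fin m) → indicator ⁅ a ⁆ t ≡ occurrences t (just a)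
indicator-⁅⁆ a t with a ≟ᶠ t
... | yes refl = indicator-∈ (x∈⁅x⁆ a)
... | no  a≢t  = indicator-∉ (a≢t ∘ sym ∘ x∈⁅y⁆⇒x≡y a)

singleton-or-other : {s : Fin m} {M : Subset m} → s ∈ M → M ≡ ⁅ s ⁆ ⊎ ∃ λ t → t ∈ M × t ≢ s
singleton-or-other {s = s} {M} s∈M with any? (λ t → (t ∈? M) ×-dec ¬? (t ≟ᶠ s))
... | yes (t , t∈M , t≢s) = inj₂ (t , t∈M , t≢s)
... | no  none            = inj₁ (⊆-antisym M⊆⁅s⁆ ⁅s⁆⊆M)
  where
  M⊆⁅s⁆ : M ⊆ ⁅ s ⁆
  M⊆⁅s⁆ {t} t∈M = subst (_∈ ⁅ s ⁆) (sym (decidable-stable (t ≟ᶠ s) λ t≢s → none (t , t∈M , t≢s))) (x∈⁅x⁆ s)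
  ⁅s⁆⊆M : ⁅ s ⁆ ⊆ M
  ⁅s⁆⊆M t∈⁅s⁆ = subst (_∈ M) (sym (x∈⁅y⁆⇒x≡y s t∈⁅s⁆)) s∈M

-- The second colour t₀ makes the new count of s positive, as needed against the colours
-- outside M, which have no token left.
majority-after-removal : {N N′ : Fin m → ℕ} {M : Subset m} {s t₀ : Fin m} →
  (∀ t → indicator M t + N′ t ≡ N t) → (∀ t → t ∉ M → N′ t ≡ 0) →
  s ∈ M → t₀ ∈ M → t₀ ≢ s → Majority N s → Majority N′ s
majority-after-removal {N = N} {N′} {M} {s} {t₀} conserved absent s∈M t₀∈M t₀≢s maj = majority′
  where
  removed : ∀ {t} → t ∈ M → suc (N′ t) ≡ N t
  removed {t} t∈M = trans (cong (_+ N′ t) (sym (indicator-∈ t∈M))) (conserved t)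

  member< : ∀ {t} → t ∈ M → t ≢ s → N′ t < N′ s
  member< t∈M t≢s = ≤-pred (subst₂ _<_ (sym (removed t∈M)) (sym (removed s∈M)) (maj _ t≢s))

  majority′ : Majority N′ s
  majority′ t t≢s with t ∈? M
  ... | yes t∈M = member< t∈M t≢s
  ... | no  t∉M = subst (_< N′ s) (sym (absent t t∉M)) (m<n⇒0<n (member< t₀∈M t₀≢s))

sieveValue : Subset m → Maybe (Fin m) → Maybe (Fin m)
sieveValue M nothing = nothing
sieveValue M (just t) with t ∈? M
... | yes _ = just t
... | no  _ = nothing

sieveMemory : Subset m → Maybe (Fin m) → Subset m
sieveMemory M nothing = M
sieveMemory M (just t) with t ∈? M
... | yes _ = M
... | no  _ = M ∪ ⁅ t ⁆

sieve-conserves : (M : Subset m) (w : Maybe (Fin m)) (t : Fin m) →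
  occurrences t w + indicator M t ≡ occurrences t (sieveValue M w) + indicator (sieveMemory M w) t
sieve-conserves M nothing t = refl
sieve-conserves M (just a) t with a ∈? M
... | yes _ = refl
... | no a∉M with a ≟ᶠ t
...   | yes refl rewrite indicator-∉ a∉M | indicator-∈ (q⊆p∪q M ⁅ a ⁆ (x∈⁅x⁆ a)) = refl
...   | no  a≢t  = sym (indicator-∪⁅⁆ (a≢t ∘ sym))

sieveMemory-⊇ : (M : Subset m) (w : Maybe (Fin m)) → M ⊆ sieveMemory M w
sieveMemory-⊇ M nothing = id
sieveMemory-⊇ M (just a) with a ∈? M
... | yes _ = id
... | no  _ = p⊆p∪q ⁅ a ⁆

sieveValue-recorded : (M : Subset m) (w : Maybe (Fin m)) {t : Fin m} →
  t ∉ sieveMemory M w → occurrences t (sieveValue M w) ≡ 0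
sieveValue-recorded M nothing _ = refl
sieveValue-recorded M (just a) {t} t∉ with a ∈? M
... | no  _   = refl
... | yes a∈M with a ≟ᶠ t
...   | yes refl = contradiction a∈M t∉
...   | no  _    = refl

data HasCounter {m : ℕ} (c : Cnt) : Sym m → Set where
  counter : ∀ v M → HasCounter c (mid c v M)

data LacksCounter {m : ℕ} (c : Cnt) : Sym m → Set where
  isBase       : ∀ t → LacksCounter c (base t)
  otherCounter : ∀ {c′} v M → c′ ≢ c → LacksCounter c (mid c′ v M)

HasCounter⇒LacksCounter-flip : ∀ {c} {z : Sym m} → HasCounter c z → LacksCounter (flipC c) z
HasCounter⇒LacksCounter-flip {c = white} (counter v M) = otherCounter v M λ ()
HasCounter⇒LacksCounter-flip {c = black} (counter v M) = otherCounter v M λ ()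

-- During a round the configuration is P ++ head ∷ R: the wave (counter c) has swept R and
-- carries the memory M in the last cell of R; P is still ahead of it.
record Round {m : ℕ} (c : Cnt) (N : Fin m → ℕ) (P R : List (Sym m)) (M : Subset m) : Set where
  field
    unvisited : All (LacksCounter c) P
    visited   : All (HasCounter c) R
    conserved : ∀ t → valueCount t P + (indicator M t + valueCount t R) ≡ N t
    recorded  : ∀ t → t ∉ M → valueCount t R ≡ 0

round-begin : ∀ {c} (pre : List (Fin m)) a rest →
  Round c (λ t → valueCount t (L.map base (pre ++ a ∷ rest))) (L.map base rest ++ L.map base pre) [] ⁅ a ⁆
round-begin pre a rest = record
  { unvisited = ++⁺ (bases rest) (bases pre)
  ; visited   = []
  ; conserved = conserved
  ; recorded  = λ _ _ → refl
  }
  where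
  open ≡-Reasoning
  bases : ∀ xs → All (LacksCounter _) (L.map base xs)
  bases xs = map⁺ (All.universal isBase xs)
  rearrange : ∀ r p o → r + p + (o + 0) ≡ p + (o + r)
  rearrange = solve-∀
  conserved : ∀ t → valueCount t (L.map base rest ++ L.map base pre) + (indicator ⁅ a ⁆ t + 0)
                    ≡ valueCount t (L.map base (pre ++ a ∷ rest))
  conserved t = begin
    valueCount t (L.map base rest ++ L.map base pre) + (indicator ⁅ a ⁆ t + 0)
      ≡⟨ cong₂ _+_ (valueCount-++ t (L.map base rest) (L.map base pre)) (cong (_+ 0) (indicator-⁅⁆ a t)) ⟩
    valueCount t (L.map base rest) + valueCount t (L.map base pre) + (occurrences t (just a) + 0)
      ≡⟨ rearrange (valueCount t (L.map base rest)) (valueCount t (L.map base pre)) (occurrences t (just a)) ⟩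
    valueCount t (L.map base pre) + (occurrences t (just a) + valueCount t (L.map base rest))
      ≡⟨ sym (valueCount-++ t (L.map base pre) (base a ∷ L.map base rest)) ⟩
    valueCount t (L.map base pre ++ base a ∷ L.map base rest)
      ≡⟨ cong (valueCount t) (sym (map-++ base pre (a ∷ rest))) ⟩
    valueCount t (L.map base (pre ++ a ∷ rest)) ∎

round-advance : ∀ {c N u P R} {M : Subset m} → Round c N (u ∷ P) R M →
  Round c N P (R ++ mid c (sieveValue M (value u)) (sieveMemory M (value u)) ∷ []) (sieveMemory M (value u))
round-advance {m} {c} {N} {u} {P} {R} {M} rnd = record
  { unvisited = All.tail unvisited
  ; visited   = ++⁺ visited (counter _ _ ∷ [])
  ; conserved = conserved′
  ; recorded  = recorded′
  }
  where
  open Round rnd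
  open ≡-Reasoning
  v′ : Maybe (Fin m)
  v′ = sieveValue M (value u)
  M′ : Subset m
  M′ = sieveMemory M (value u)
  shuffle₁ : ∀ p i′ r o′ → p + (i′ + (r + (o′ + 0))) ≡ p + r + (o′ + i′)
  shuffle₁ = solve-∀
  shuffle₂ : ∀ p r o i → p + r + (o + i) ≡ o + p + (i + r)
  shuffle₂ = solve-∀
  conserved′ : ∀ t → valueCount t P + (indicator M′ t + valueCount t (R ++ mid c v′ M′ ∷ [])) ≡ N t
  conserved′ t = begin
    valueCount t P + (indicator M′ t + valueCount t (R ++ mid c v′ M′ ∷ []))
      ≡⟨ cong (λ r → valueCount t P + (indicator M′ t + r)) (valueCount-++ t R _) ⟩
    valueCount t P + (indicator M′ t + (valueCount t R + (occurrences t v′ + 0)))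
      ≡⟨ shuffle₁ (valueCount t P) (indicator M′ t) (valueCount t R) (occurrences t v′) ⟩
    valueCount t P + valueCount t R + (occurrences t v′ + indicator M′ t)
      ≡⟨ cong (valueCount t P + valueCount t R +_) (sym (sieve-conserves M (value u) t)) ⟩
    valueCount t P + valueCount t R + (occurrences t (value u) + indicator M t)
      ≡⟨ shuffle₂ (valueCount t P) (valueCount t R) (occurrences t (value u)) (indicator M t) ⟩
    valueCount t (u ∷ P) + (indicator M t + valueCount t R)
      ≡⟨ conserved t ⟩
    N t ∎
  recorded′ : ∀ t → t ∉ M′ → valueCount t (R ++ mid c v′ M′ ∷ []) ≡ 0
  recorded′ t t∉M′ = begin
    valueCount t (R ++ mid c v′ M′ ∷ [])        ≡⟨ valueCount-++ t R _ ⟩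
    valueCount t R + (occurrences t v′ + 0)     ≡⟨ cong₂ (λ r o → r + (o + 0)) (recorded t (t∉M′ ∘ sieveMemory-⊇ M (value u)))
                                                                              (sieveValue-recorded M (value u) t∉M′) ⟩
    0                                           ∎

memory-complete : ∀ {c N R} {M : Subset m} → Round c N [] R M → ∀ t → 0 < N t → t ∈ M
memory-complete {N = N} {M = M} rnd t 0<Nt with t ∈? M
... | yes t∈M = t∈M
... | no  t∉M = contradiction (subst (0 <_) Nt≡0 0<Nt) λ ()
  where
  open Round rnd
  Nt≡0 : N t ≡ 0
  Nt≡0 = trans (sym (conserved t)) (cong₂ _+_ (indicator-∉ t∉M) (recorded t t∉M))

round-restart : ∀ {c N R} {M : Subset m} → Round c N [] R M →
  Round (flipC c) (λ t → valueCount t R) R [] ∅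
round-restart {R = R} rnd = record
  { unvisited = All.map HasCounter⇒LacksCounter-flip visited
  ; visited   = []
  ; conserved = λ t → trans (cong (λ i → valueCount t R + (i + 0)) (indicator-∉ {t = t} {M = ∅} ∉⊥)) (+-identityʳ _)
  ; recorded  = λ _ _ → refl
  }
  where open Round rnd

module LocalRule {m : ℕ} (g : Default m) where

  open Rotation (f g) public

  f-equal : (s : Fin m) → f g (base s) (base s) ≡ base s
  f-equal s with s ≟ᶠ s
  ... | yes _   = refl
  ... | no  s≢s = contradiction refl s≢s

  f-distinct : {s t : Fin m} → s ≢ t → f g (base s) (base t) ≡ mid white nothing ⁅ t ⁆
  f-distinct {s} {t} s≢t with s ≟ᶠ t
  ... | yes s≡t = contradiction s≡t s≢t
  ... | no  _   = refl

  f-sieve : ∀ {c v M} {y : Sym m} → LacksCounter c y →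
            f g (mid c v M) y ≡ mid c (sieveValue M (value y)) (sieveMemory M (value y))
  f-sieve {M = M} (isBase t) with t ∈? M
  ... | yes _ = refl
  ... | no  _ = refl
  f-sieve {c} (otherCounter {c′} _ _ c′≢c) with c ≟ᶜ c′
  ... | yes c≡c′ = contradiction (sym c≡c′) c′≢c
  f-sieve (otherCounter nothing  _ _) | no _ = refl
  f-sieve {M = M} (otherCounter (just u) _ _) | no _ with u ∈? M
  ... | yes _ = refl
  ... | no  _ = refl

  f-singleton : ∀ {c v w M₀ s} {M : Subset m} → M ≡ ⁅ s ⁆ → f g (mid c v M) (mid c w M₀) ≡ base s
  f-singleton {c} {s = s} refl with c ≟ᶜ c
  ... | no  c≢c = contradiction refl c≢c
  ... | yes _ with ≡-dec _≟ᵇ_ ⁅ s ⁆ ∅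
  ...   | yes ⁅s⁆≡∅ = contradiction (subst (s ∈_) ⁅s⁆≡∅ (x∈⁅x⁆ s)) ∉⊥
  ...   | no  _ with any? (λ t → ≡-dec _≟ᵇ_ ⁅ s ⁆ ⁅ t ⁆)
  ...     | yes (t , ⁅s⁆≡⁅t⁆) = cong base (sym (x∈⁅y⁆⇒x≡y t (subst (s ∈_) ⁅s⁆≡⁅t⁆ (x∈⁅x⁆ s))))
  ...     | no  none           = contradiction (s , refl) none

  f-nonsingleton : ∀ {c v w M₀ s t} {M : Subset m} → s ∈ M → t ∈ M → t ≢ s →
                   f g (mid c v M) (mid c w M₀) ≡ mid (flipC c) nothing ∅
  f-nonsingleton {c} {M = M} s∈M t∈M t≢s with c ≟ᶜ c
  ... | no  c≢c = contradiction refl c≢c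
  ... | yes _ with ≡-dec _≟ᵇ_ M ∅
  ...   | yes M≡∅ = contradiction (subst (_ ∈_) M≡∅ s∈M) ∉⊥
  ...   | no  _ with any? (λ u → ≡-dec _≟ᵇ_ M ⁅ u ⁆)
  ...     | no  _        = refl
  ...     | yes (u , M≡⁅u⁆) = contradiction (trans (inSingleton t∈M) (sym (inSingleton s∈M))) t≢s
    where
    inSingleton : ∀ {x} → x ∈ M → x ≡ u
    inSingleton x∈M = x∈⁅y⁆⇒x≡y u (subst (_ ∈_) M≡⁅u⁆ x∈M)

  sweepList-opening : ∀ {b a : Fin m} {pre} → All (_≡ b) pre → a ≢ b →
    sweepList (base b) (L.map base pre ++ base a ∷ []) ≡ L.map base pre ++ mid white nothing ⁅ a ⁆ ∷ []
  sweepList-opening []                    a≢b = cong (_∷ []) (f-distinct (a≢b ∘ sym))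
  sweepList-opening {b} (refl ∷ pre≡b) a≢b rewrite f-equal b = cong (base b ∷_) (sweepList-opening pre≡b a≢b)

  toList-sweep : ∀ d (v : Vec (Sym m) n) → toList (sweep g d v) ≡ sweepList d (toList v)
  toList-sweep d []      = refl
  toList-sweep d (y ∷ v) = cong (f g d y ∷_) (toList-sweep (f g d y) v)

  toList-F : (v : Vec (Sym m) n) → toList (F g v) ≡ iter n rotate (toList v)
  toList-F []      = refl
  toList-F {suc n} (x ∷ v) = begin
    toList (sweep g (last (x ∷ v)) (x ∷ v))              ≡⟨ toList-sweep (last (x ∷ v)) (x ∷ v) ⟩
    sweepList (last (x ∷ v)) (x ∷ toList v)              ≡⟨ cong (λ d → sweepList d (x ∷ toList v)) (last≡lastOr x v) ⟩
    sweepList (lastOr x (toList v)) (x ∷ toList v)       ≡⟨ sym (iter-rotate-cycle x (toList v)) ⟩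
    iter (suc (length (toList v))) rotate (toList (x ∷ v)) ≡⟨ cong (λ k → iter (suc k) rotate (toList (x ∷ v))) (length-toList v) ⟩
    iter (suc n) rotate (toList (x ∷ v))                 ∎
    where open ≡-Reasoning

  toList-iter-F : ∀ k (v : Vec (Sym m) n) → toList (iter k (F g) v) ≡ iter (k * n) rotate (toList v)
  toList-iter-F zero    v = refl
  toList-iter-F {n} (suc k) v = begin
    toList (F g (iter k (F g) v))                       ≡⟨ toList-F _ ⟩
    iter n rotate (toList (iter k (F g) v))             ≡⟨ cong (iter n rotate) (toList-iter-F k v) ⟩
    iter n rotate (iter (k * n) rotate (toList v))      ≡⟨ sym (iter-+ n (k * n) rotate _) ⟩
    iter (suc k * n) rotate (toList v)                  ∎
    where open ≡-Reasoning

module Convergence {m : ℕ} (g : Default m) (s : Fin m) where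

  open LocalRule g

  Uniform : List (Sym m) → Set
  Uniform = All (_≡ base s)

  iter-rotate-Uniform : ∀ {zs} → Uniform zs → ∀ k → Uniform (iter k rotate zs)
  iter-rotate-Uniform = iter-rotate-All λ { refl refl → f-equal s }

  Uniformizes : List (Sym m) → Set
  Uniformizes zs = ∃ λ j → Uniform (iter j rotate zs)

  uniformizes-iter : ∀ j {zs} → Uniformizes (iter j rotate zs) → Uniformizes zs
  uniformizes-iter j {zs} (k , u) = k + j , subst Uniform (sym (iter-+ k j rotate zs)) u

  uniformizes⇒eventually : ∀ {zs} → Uniformizes zs → ∃ λ J → ∀ k → J ≤ k → Uniform (iter k rotate zs)
  uniformizes⇒eventually {zs} (J , u) = J , λ k J≤k →
    subst Uniform (trans (sym (iter-+ (k ∸ J) J rotate zs)) (cong (λ j → iter j rotate zs) (m∸n+n≡m J≤k)))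
          (iter-rotate-Uniform u (k ∸ J))

  sweepList-settles : ∀ {c R} → All (HasCounter c) R → Uniform (sweepList (base s) R)
  sweepList-settles []                 = []
  sweepList-settles (counter _ _ ∷ hR) = refl ∷ sweepList-settles hR

  settle : ∀ {c R} → All (HasCounter c) R → Uniformizes (R ++ base s ∷ [])
  settle {R = R} hR =
    length R , subst Uniform (sym (iter-rotate (base s) R (base s ∷ []) (lastOr-∷ʳ (base s) R (base s))))
                             (refl ∷ sweepList-settles hR)

  -- The recursion is on n, where N s = n + 1: every restart of the wave removes one token of s.
  mutual
    round⇒uniformizes : ∀ n {c N M₀ v M} P R → Majority N s → N s ≡ suc n → Round c N P R M →
                        lastOr (mid c nothing M₀) R ≡ mid c v M → Uniformizes (P ++ mid c nothing M₀ ∷ R)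
    round⇒uniformizes n []      R maj Ns rnd front = roundEnd⇒uniformizes n R maj Ns rnd front
    round⇒uniformizes n {c} {M₀ = M₀} {v} {M} (u ∷ P) R maj Ns rnd front =
      uniformizes-iter 1 (subst Uniformizes advanced
        (round⇒uniformizes n P _ maj Ns (round-advance rnd) (lastOr-∷ʳ _ R _)))
      where
      open ≡-Reasoning
      q₀ z′ : Sym m
      q₀ = mid c nothing M₀
      z′ = mid c (sieveValue M (value u)) (sieveMemory M (value u))
      advanced : P ++ q₀ ∷ (R ++ z′ ∷ []) ≡ rotate (u ∷ P ++ q₀ ∷ R)
      advanced = sym (begin
        (P ++ q₀ ∷ R) ++ f g (lastOr u (P ++ q₀ ∷ R)) u ∷ []
          ≡⟨ cong (λ d → (P ++ q₀ ∷ R) ++ f g d u ∷ []) (trans (lastOr-++-∷ u P q₀ R) front) ⟩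
        (P ++ q₀ ∷ R) ++ f g (mid c v M) u ∷ []
          ≡⟨ cong (λ z → (P ++ q₀ ∷ R) ++ z ∷ []) (f-sieve (All.head (Round.unvisited rnd))) ⟩
        (P ++ q₀ ∷ R) ++ z′ ∷ []
          ≡⟨ ++-assoc P (q₀ ∷ R) (z′ ∷ []) ⟩
        P ++ q₀ ∷ (R ++ z′ ∷ []) ∎)

    roundEnd⇒uniformizes : ∀ n {c N M₀ v M} R → Majority N s → N s ≡ suc n → Round c N [] R M →
                           lastOr (mid c nothing M₀) R ≡ mid c v M → Uniformizes (mid c nothing M₀ ∷ R)
    roundEnd⇒uniformizes n {c} {N} {M₀} {v} {M} R maj Ns rnd front =
      uniformizes-iter 1 (subst (λ d → Uniformizes (R ++ f g d q₀ ∷ [])) (sym front)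
        (closing (singleton-or-other s∈M)))
      where
      open Round rnd
      q₀ : Sym m
      q₀ = mid c nothing M₀
      s∈M : s ∈ M
      s∈M = memory-complete rnd s (subst (0 <_) (sym Ns) (s≤s z≤n))

      restart : ∀ n′ → valueCount s R ≡ n′ → Majority (λ t → valueCount t R) s → 0 < valueCount s R →
                Uniformizes (R ++ mid (flipC c) nothing ∅ ∷ [])
      restart zero     Rs≡0 _    0<Rs = contradiction (subst (0 <_) Rs≡0 0<Rs) λ ()
      restart (suc n′) Rs≡n maj′ _    = round⇒uniformizes n′ R [] maj′ Rs≡n (round-restart rnd) refl

      closing : M ≡ ⁅ s ⁆ ⊎ ∃ (λ t → t ∈ M × t ≢ s) → Uniformizes (R ++ f g (mid c v M) q₀ ∷ [])
      closing (inj₁ M≡⁅s⁆) =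
        subst (λ z → Uniformizes (R ++ z ∷ [])) (sym (f-singleton {c} {v} {nothing} {M₀} M≡⁅s⁆)) (settle visited)
      closing (inj₂ (t₀ , t₀∈M , t₀≢s)) =
        subst (λ z → Uniformizes (R ++ z ∷ [])) (sym (f-nonsingleton {c} {v} {nothing} {M₀} s∈M t₀∈M t₀≢s))
          (restart n Rs≡n maj′ (m<n⇒0<n (maj′ t₀ t₀≢s)))
        where
        Rs≡n : valueCount s R ≡ n
        Rs≡n = suc-injective (trans (cong (_+ valueCount s R) (sym (indicator-∈ s∈M))) (trans (conserved s) Ns))
        maj′ : Majority (λ t → valueCount t R) s
        maj′ = majority-after-removal conserved recorded s∈M t₀∈M t₀≢s maj

  majority⇒uniformizes : ∀ xs {b} → lastOr b xs ≡ b → Majority (λ t → valueCount t (L.map base xs)) s →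
          0 < valueCount s (L.map base xs) → Uniformizes (L.map base xs)
  majority⇒uniformizes xs {b} last≡b maj pos with First.first (λ x → toSum (x ≟ᶠ b)) xs
  ... | inj₂ all≡b = 0 , map⁺ (All.map (λ x≡b → cong base (trans x≡b b≡s)) all≡b)
    where
    b≡s : b ≡ s
    b≡s = decidable-stable (b ≟ᶠ s) λ b≢s → contradiction (subst (0 <_) (valueCount-absent xs all≡b b≢s) pos) λ ()
  ... | inj₁ first≢b with toView first≢b
  ...   | First._++_∷_ {pre} {a} pre≡b a≢b rest =
    uniformizes-iter (length ys) (subst Uniformizes (sym opened)
      (round⇒uniformizes (pred (valueCount s (L.map base (pre ++ a ∷ rest))))
                         (L.map base rest ++ L.map base pre) []
                         maj (sym (suc-pred _ {{>-nonZero pos}})) (round-begin pre a rest) refl))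
    where
    open ≡-Reasoning
    ys : List (Sym m)
    ys = L.map base pre ++ base a ∷ []
    q₀ : Sym m
    q₀ = mid white nothing ⁅ a ⁆
    split : L.map base (pre ++ a ∷ rest) ≡ ys ++ L.map base rest
    split = trans (map-++ base pre (a ∷ rest)) (sym (++-assoc (L.map base pre) (base a ∷ []) (L.map base rest)))
    opened : iter (length ys) rotate (L.map base (pre ++ a ∷ rest)) ≡ (L.map base rest ++ L.map base pre) ++ q₀ ∷ []
    opened = begin
      iter (length ys) rotate (L.map base (pre ++ a ∷ rest))  ≡⟨ cong (iter (length ys) rotate) split ⟩
      iter (length ys) rotate (ys ++ L.map base rest)         ≡⟨ iter-rotate (base b) ys (L.map base rest) lastCell ⟩
      L.map base rest ++ sweepList (base b) ys                ≡⟨ cong (L.map base rest ++_) (sweepList-opening pre≡b a≢b) ⟩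
      L.map base rest ++ L.map base pre ++ q₀ ∷ []            ≡⟨ sym (++-assoc (L.map base rest) (L.map base pre) (q₀ ∷ [])) ⟩
      (L.map base rest ++ L.map base pre) ++ q₀ ∷ []          ∎
      where
      lastCell : lastOr (base b) (ys ++ L.map base rest) ≡ base b
      lastCell = trans (cong (lastOr (base b)) (sym split)) (trans (lastOr-map base b (pre ++ a ∷ rest)) (cong base last≡b))

theorem2 : (m : ℕ) (g : Default m) (n : ℕ) → 1 ≤ n →
    (x : Vec (Fin m) n) (s : Fin m) →
    (∀ (t : Fin m) → t ≢ s → occ t x < occ s x) →
      (∃ λ K → ∀ k → k ≥ K → iter k (F g) (map base x) ≡ replicate n (base s))
      × (F g (replicate n (base s)) ≡ replicate n (base s))
theorem2 m g (suc n) (s≤s _) x@(x₀ ∷ xs) s maj = (proj₁ eventually , converges) , fixed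
  where
  open LocalRule g
  open Convergence g s
  cells : List (Sym m)
  cells = L.map base (toList x)
  maj′ : Majority (λ t → valueCount t cells) s
  maj′ t t≢s = subst₂ _<_ (occ≡valueCount t x) (occ≡valueCount s x) (maj t t≢s)
  eventually : ∃ λ K → ∀ k → K ≤ k → Uniform (iter k rotate cells)
  eventually =
    uniformizes⇒eventually (majority⇒uniformizes (toList x) refl maj′ (majority-occurs x₀ (toList xs) maj′))
  converges : ∀ k → k ≥ proj₁ eventually → iter k (F g) (map base x) ≡ replicate (suc n) (base s)
  converges k K≤k = All≡⇒replicate _ (subst Uniform
    (sym (trans (toList-iter-F k (map base x)) (cong (iter (k * suc n) rotate) (toList-map base x))))
    (proj₂ eventually (k * suc n) (≤-trans K≤k (m≤m*n k (suc n)))))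
  fixed : F g (replicate (suc n) (base s)) ≡ replicate (suc n) (base s)
  fixed = All≡⇒replicate _ (subst Uniform (sym (toList-F (replicate (suc n) (base s))))
    (iter-rotate-Uniform (subst Uniform (sym (toList-replicate (suc n) (base s))) (replicate⁺ (suc n) refl)) (suc n)))
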